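{- For every nonnegative integer $k$, $$\sum_{n=0}^k\binom{n+k}{n}2^n=(-1)^{k+1}-(-2)^{k+1}\sum_{n=0}^k\binom{n+k}{n}(-1)^n.$$ -}

module Defs where

open import Data.Nat using (ℕ; zero; suc)
open import Data.Integer using (ℤ; _+_)

-- Σ[n=0..k] f n  (inclusive upper bound k)
sumTo : ℕ → (ℕ → ℤ) → ℤ
sumTo zero    f = f zero
sumTo (suc k) f = sumTo k f + f (suc k)

{-# OPTIONS --safe #-}
module Submission where

-- Write Sₖ(x) = Σ_{n≤k} C(n+k,n) xⁿ and c = C(2k+1,k+1). Pascal's rule splits S_{k+1}(x) into
-- Sₖ(x) + c x^{k+1} plus x times S_{k+1}(x) without its last term, and that last term is
-- 2c x^{k+1} because C(2k+2,k+1) = 2c. Hence (1 − x) S_{k+1}(x) = Sₖ(x) + (1 − 2x) c x^{k+1}.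
-- At x = 2 and x = −1 the correction terms are −3c·2^{k+1} and 3c(−1)^{k+1}, which agree up to
-- the factor (−2)^{k+1} since (−2)^{k+1}(−1)^{k+1} = 2^{k+1}; so induction on k goes through.

open import Defs
open import Data.Nat using (ℕ; zero; suc; _∸_) renaming (_+_ to _+ℕ_; _*_ to _*ℕ_)
open import Data.Nat.Combinatorics using (_C_; nCk+nC[k+1]≡[n+1]C[k+1]; nCk≡nC[n∸k])
import Data.Nat.Properties as ℕ
open import Data.Integer using (ℤ; +_; -_; _+_; _-_; _*_; _^_)
open import Data.Integer.Properties using
  (pos-+; pos-*; *-assoc; *-distribʳ-+; +-commutativeSemigroup; *-commutativeSemigroup)
open import Algebra.Properties.CommutativeSemigroup *-commutativeSemigroup using (interchange; x∙yz≈y∙xz)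
open import Algebra.Properties.CommutativeSemigroup +-commutativeSemigroup
  using () renaming (x∙yz≈xz∙y to x+[y+z]≡x+z+y)
open import Data.Integer.Tactic.RingSolver using (solve-∀)
open import Relation.Binary.PropositionalEquality using (_≡_; refl; cong; cong₂; module ≡-Reasoning)
open ≡-Reasoning

^-distrib-* : ∀ i j n → (i * j) ^ n ≡ i ^ n * j ^ n
^-distrib-* i j zero    = refl
^-distrib-* i j (suc n) = begin
  i * j * (i * j) ^ n        ≡⟨ cong (i * j *_) (^-distrib-* i j n) ⟩
  i * j * (i ^ n * j ^ n)    ≡⟨ interchange i j (i ^ n) (j ^ n) ⟩
  i * i ^ n * (j * j ^ n)    ∎

[1+k+1+k]C[1+k]≡2*[1+k+k]C[1+k] : ∀ k → (suc k +ℕ suc k) C suc k ≡ 2 *ℕ ((suc k +ℕ k) C suc k)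
[1+k+1+k]C[1+k]≡2*[1+k+k]C[1+k] k = begin
  (suc k +ℕ suc k) C suc k                      ≡⟨ nCk+nC[k+1]≡[n+1]C[k+1] (k +ℕ suc k) k ⟨
  (k +ℕ suc k) C k +ℕ (k +ℕ suc k) C suc k      ≡⟨ cong (λ n → n C k +ℕ n C suc k) (ℕ.+-suc k k) ⟩
  (suc k +ℕ k) C k +ℕ (suc k +ℕ k) C suc k      ≡⟨ cong (_+ℕ (suc k +ℕ k) C suc k) C-symmetric ⟩
  (suc k +ℕ k) C suc k +ℕ (suc k +ℕ k) C suc k  ≡⟨ cong (m +ℕ_) (ℕ.+-identityʳ m) ⟨
  2 *ℕ m                                        ∎
  where
  m = (suc k +ℕ k) C suc k
  C-symmetric : (suc k +ℕ k) C k ≡ (suc k +ℕ k) C suc k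
  C-symmetric = begin
    (suc k +ℕ k) C k                 ≡⟨ nCk≡nC[n∸k] (ℕ.m≤n+m k (suc k)) ⟩
    (suc k +ℕ k) C (suc k +ℕ k ∸ k)  ≡⟨ cong ((suc k +ℕ k) C_) (ℕ.m+n∸n≡m (suc k) k) ⟩
    (suc k +ℕ k) C suc k             ∎

summand : ℤ → ℕ → ℕ → ℤ
summand x k n = + ((n +ℕ k) C n) * x ^ n

partialSum : ℤ → ℕ → ℕ → ℤ
partialSum x k m = sumTo m (summand x k)

diagonalSum : ℤ → ℕ → ℤ
diagonalSum x k = partialSum x k k

summand-pascal : ∀ x k n → summand x (suc k) (suc n) ≡ x * summand x (suc k) n + summand x k (suc n)
summand-pascal x k n = begin
  + ((suc n +ℕ suc k) C suc n) * (x * x ^ n)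
    ≡⟨ cong (λ m → + m * (x * x ^ n)) (nCk+nC[k+1]≡[n+1]C[k+1] (n +ℕ suc k) n) ⟨
  + (a +ℕ (n +ℕ suc k) C suc n) * (x * x ^ n)
    ≡⟨ cong (λ m → + (a +ℕ m C suc n) * (x * x ^ n)) (ℕ.+-suc n k) ⟩
  + (a +ℕ b) * (x * x ^ n)
    ≡⟨ cong (_* (x * x ^ n)) (pos-+ a b) ⟩
  (+ a + + b) * (x * x ^ n)
    ≡⟨ *-distribʳ-+ (x * x ^ n) (+ a) (+ b) ⟩
  + a * (x * x ^ n) + + b * (x * x ^ n)
    ≡⟨ cong (_+ + b * (x * x ^ n)) (x∙yz≈y∙xz (+ a) x (x ^ n)) ⟩
  x * (+ a * x ^ n) + + b * (x * x ^ n) ∎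
  where
  a = (n +ℕ suc k) C n
  b = (suc n +ℕ k) C suc n

partialSum-pascal : ∀ x k m →
  partialSum x (suc k) (suc m) ≡ partialSum x k (suc m) + x * partialSum x (suc k) m
partialSum-pascal x k zero = begin
  + 1 + summand x (suc k) 1        ≡⟨ cong (λ t → + 1 + t) (summand-pascal x k 0) ⟩
  + 1 + (x * + 1 + summand x k 1)  ≡⟨ x+[y+z]≡x+z+y (+ 1) (x * + 1) (summand x k 1) ⟩
  + 1 + summand x k 1 + x * + 1    ∎
partialSum-pascal x k (suc m) = begin
  partialSum x (suc k) (suc m) + summand x (suc k) (suc (suc m))
    ≡⟨ cong₂ _+_ (partialSum-pascal x k m) (summand-pascal x k (suc m)) ⟩
  partialSum x k (suc m) + x * partialSum x (suc k) m
    + (x * summand x (suc k) (suc m) + summand x k (suc (suc m)))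
    ≡⟨ regroup x (partialSum x k (suc m)) (partialSum x (suc k) m)
               (summand x (suc k) (suc m)) (summand x k (suc (suc m))) ⟩
  partialSum x k (suc m) + summand x k (suc (suc m))
    + x * (partialSum x (suc k) m + summand x (suc k) (suc m)) ∎
  where
  regroup : ∀ x a b c d → a + x * b + (x * c + d) ≡ a + d + x * (b + c)
  regroup = solve-∀

summand-diagonal : ∀ x k → summand x (suc k) (suc k) ≡ + 2 * summand x k (suc k)
summand-diagonal x k = begin
  + ((suc k +ℕ suc k) C suc k) * x ^ suc k
    ≡⟨ cong (λ m → + m * x ^ suc k) ([1+k+1+k]C[1+k]≡2*[1+k+k]C[1+k] k) ⟩
  + (2 *ℕ c) * x ^ suc k
    ≡⟨ cong (_* x ^ suc k) (pos-* 2 c) ⟩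
  + 2 * + c * x ^ suc k
    ≡⟨ *-assoc (+ 2) (+ c) (x ^ suc k) ⟩
  + 2 * (+ c * x ^ suc k)
    ∎
  where
  c = (suc k +ℕ k) C suc k

diagonalSum-recurrence : ∀ x k →
  (+ 1 - x) * diagonalSum x (suc k) ≡ diagonalSum x k + (+ 1 - + 2 * x) * summand x k (suc k)
diagonalSum-recurrence x k = begin
  (+ 1 - x) * diagonalSum x (suc k)
    ≡⟨ expand x (diagonalSum x (suc k)) ⟩
  diagonalSum x (suc k) - x * diagonalSum x (suc k)
    ≡⟨ cong₂ (λ u v → u - x * v) (partialSum-pascal x k k)
                                  (cong (λ t → P + t) (summand-diagonal x k)) ⟩
  diagonalSum x k + s + x * P - x * (P + + 2 * s)
    ≡⟨ cancel x (diagonalSum x k) s P ⟩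
  diagonalSum x k + (+ 1 - + 2 * x) * s ∎
  where
  P = partialSum x (suc k) k
  s = summand x k (suc k)
  expand : ∀ x y → (+ 1 - x) * y ≡ y - x * y
  expand = solve-∀
  cancel : ∀ x S s P → S + s + x * P - x * (P + + 2 * s) ≡ S + (+ 1 - + 2 * x) * s
  cancel = solve-∀

lemma2p3 : (k : ℕ) →
    sumTo k (λ n → + ((n +ℕ k) C n) * (+ 2) ^ n)
      ≡ (- + 1) ^ suc k - ((- + 2) ^ suc k) * sumTo k (λ n → + ((n +ℕ k) C n) * (- + 1) ^ n)
lemma2p3 zero    = refl
lemma2p3 (suc k) = begin
  -- the recurrence at x = 2 and x = −1, where 1 − x and 1 − 2x compute to −1, −3 and 2, 3
  diagonalSum (+ 2) (suc k)
    ≡⟨ negate-twice (diagonalSum (+ 2) (suc k)) ⟩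
  - (- + 1 * diagonalSum (+ 2) (suc k))
    ≡⟨ cong -_ (diagonalSum-recurrence (+ 2) k) ⟩
  - (diagonalSum (+ 2) k + - + 3 * (c * (+ 2) ^ suc k))
    ≡⟨ cong₂ (λ a t → - (a + - + 3 * (c * t))) (lemma2p3 k) (^-distrib-* (- + 2) (- + 1) (suc k)) ⟩
  - (p - q * B + - + 3 * (c * (q * p)))
    ≡⟨ collect p q B c ⟩
  - p + q * (B + + 3 * (c * p))
    ≡⟨ cong (λ b → - p + q * b) (diagonalSum-recurrence (- + 1) k) ⟨
  - p + q * (+ 2 * B′)
    ≡⟨ unfold-powers p q B′ ⟩
  (- + 1) ^ suc (suc k) - (- + 2) ^ suc (suc k) * B′ ∎
  where
  c = + ((suc k +ℕ k) C suc k)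
  p = (- + 1) ^ suc k
  q = (- + 2) ^ suc k
  B = diagonalSum (- + 1) k
  B′ = diagonalSum (- + 1) (suc k)
  negate-twice : ∀ a → a ≡ - (- + 1 * a)
  negate-twice = solve-∀
  collect : ∀ p q b c → - (p - q * b + - + 3 * (c * (q * p))) ≡ - p + q * (b + + 3 * (c * p))
  collect = solve-∀
  unfold-powers : ∀ p q b → - p + q * (+ 2 * b) ≡ - + 1 * p - - + 2 * q * b
  unfold-powers = solve-∀
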